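{- Let $s,t \geq 1$ be integers and let $\alpha_{s,t}$ be the type-$\alpha$ comb with $s$ teeth of length $t$. Then exactly one linear extension of $\alpha_{s,t}$ avoids the pattern $132$.
   Context: A linear extension of a finite poset $P$ on a set of integers is a listing $v=[v_1,\dots,v_n]$ of all elements of $P$, each exactly once, such that whenever $a \leq_P b$, $a$ appears before $b$. For $w \in S_3$, a sequence $v$ of distinct integers contains $w$ if there are indices $i<j<k$ with $(v_i,v_j,v_k)$ in the same relative order as $(w_1,w_2,w_3)$; otherwise $v$ avoids $w$. The type-$\alpha$ comb $\alpha_{s,t}$ is the poset on $\{1,\dots,st\}$ whose order is generated by the relations $i \leq i+1$ for $1 \leq i \leq s-1$ (the spine $1,\dots,s$) and $x \leq x+s$ for $1 \leq x \leq (t-1)s$ (so the teeth are $c, c+s, \dots, c+(t-1)s$ for $1\le c\le s$). -}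

module Defs where

open import Data.Nat using (ℕ; _+_; _*_; _∸_; _≤_; _<_; suc)
open import Data.List using (List; length; lookup)
open import Data.List.Membership.Propositional using (_∈_)
open import Data.List.Relation.Unary.Unique.Propositional using (Unique)
open import Data.Fin using (Fin) renaming (_<_ to _<ᶠ_; _≤_ to _≤ᶠ_)
open import Data.Product using (_×_; ∃; ∃-syntax)
open import Data.Sum using (_⊎_)
open import Relation.Binary.PropositionalEquality using (_≡_)
open import Relation.Binary.Construct.Closure.ReflexiveTransitive using (Star)
open import Function.Bundles using (_⇔_)
open import Relation.Nullary using (¬_)

data CombGen (s t : ℕ) : ℕ → ℕ → Set where
  spine : ∀ {i} → 1 ≤ i → i ≤ s ∸ 1 → CombGen s t i (suc i)
  tooth : ∀ {x} → 1 ≤ x → x ≤ (t ∸ 1) * s → CombGen s t x (x + s)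

CombLe : (s t : ℕ) → ℕ → ℕ → Set
CombLe s t = Star (CombGen s t)

IsListingOf : (n : ℕ) → List ℕ → Set
IsListingOf n v = Unique v × (∀ x → (x ∈ v) ⇔ (1 ≤ x × x ≤ n))

IsLinExt : (s t : ℕ) → List ℕ → Set
IsLinExt s t v =
  IsListingOf (s * t) v ×
  (∀ (i j : Fin (length v)) → CombLe s t (lookup v i) (lookup v j) → i ≤ᶠ j)

Contains132 : List ℕ → Set
Contains132 v = ∃[ i ] ∃[ j ] ∃[ k ]
  (i <ᶠ j × j <ᶠ k × lookup v i < lookup v k × lookup v k < lookup v j)

Avoids132 : List ℕ → Set
Avoids132 v = ¬ Contains132 v

-- The comb order refines the usual order on {1,…,st} and every x ≥ 2 has a lower cover
-- (x − 1 on the spine, x − s on a tooth), so a linear extension must start with 1.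
-- Every later entry exceeds 1, so a descent after the first position would form a 132
-- pattern with that leading 1. Hence a 132-avoiding linear extension is strictly
-- increasing, and the only strictly increasing listing of {1,…,st} is 1, 2, …, st,
-- which is indeed a 132-avoiding linear extension.
module Submission where

open import Defs
open import Data.Nat using (ℕ; _≤_)
open import Data.List using (List)
open import Data.Product using (_×_; ∃-syntax)
open import Relation.Binary.PropositionalEquality using (_≡_)

open import Level using (Level)
open import Data.Nat using (zero; suc; _*_; _∸_; _<_; z≤n; s≤s; _≤?_)
open import Data.Nat.Properties
open import Data.List using ([]; _∷_; lookup; applyUpTo)
open import Data.Fin using () renaming (zero to fzero; suc to fsuc; _<_ to _<ᶠ_)
open import Data.Product using (_,_; proj₁; proj₂)
open import Data.Empty using (⊥-elim)
open import Relation.Nullary using (¬_; yes; no; contradiction)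
open import Relation.Binary.Core using (Rel)
open import Relation.Binary.Definitions using (Asymmetric; tri<; tri≈; tri>)
open import Relation.Binary.PropositionalEquality using (refl; sym; subst; cong; cong₂)
open import Relation.Binary.Construct.Closure.ReflexiveTransitive using (ε; _◅_)
open import Data.List.Membership.Propositional using (_∈_)
open import Data.List.Membership.Propositional.Properties
  using (∈-lookup; ∈-applyUpTo⁺; ∈-applyUpTo⁻)
open import Data.List.Relation.Unary.Any as Any using (here; there)
open import Data.List.Relation.Unary.Any.Properties using (lookup-index)
open import Data.List.Relation.Unary.All as All using (All; _∷_)
open import Data.List.Relation.Unary.Unique.Propositional using (Unique)
open import Data.List.Relation.Unary.AllPairs as AllPairs using (AllPairs; []; _∷_)
open import Data.List.Relation.Unary.AllPairs.Properties using (applyUpTo⁺₁)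
open import Function.Bundles using (_⇔_; mk⇔; Equivalence)
import Function.Properties.Equivalence as ⇔

open Equivalence using (to; from)

private
  variable
    a ℓ : Level
    A : Set a
    s t : ℕ

module _ {R : Rel A ℓ} where

  AllPairs-lookup : ∀ {xs} → AllPairs R xs →
                    ∀ {i j} → i <ᶠ j → R (lookup xs i) (lookup xs j)
  AllPairs-lookup (Rx ∷ _)   {fzero}  {fsuc j} _         = All.lookup Rx (∈-lookup j)
  AllPairs-lookup (_ ∷ Rxs) {fsuc i} {fsuc j} (s≤s i<j) = AllPairs-lookup Rxs i<j

  lookup⇒AllPairs : ∀ {xs} → (∀ {i j} → i <ᶠ j → R (lookup xs i) (lookup xs j)) →
                    AllPairs R xs
  lookup⇒AllPairs {[]}     _ = []
  lookup⇒AllPairs {x ∷ xs} R-lookup =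
    All.tabulate (λ x∈xs → subst (R x) (sym (lookup-index x∈xs)) (R-lookup (s≤s z≤n)))
    ∷ lookup⇒AllPairs (λ i<j → R-lookup (s≤s i<j))

  private
    heads-≡ : Asymmetric R → ∀ {x y xs ys} → AllPairs R (x ∷ xs) → AllPairs R (y ∷ ys) →
              (∀ z → z ∈ x ∷ xs ⇔ z ∈ y ∷ ys) → x ≡ y
    heads-≡ asym {x} {y} (Rx ∷ _) (Ry ∷ _) same
      with to (same x) (here refl) | from (same y) (here refl)
    ... | here x≡y   | _          = x≡y
    ... | there _    | here y≡x   = sym y≡x
    ... | there x∈ys | there y∈xs = ⊥-elim (asym (All.lookup Rx y∈xs) (All.lookup Ry x∈ys))

    tails-∈ : Asymmetric R → ∀ {x us vs z} → All (R x) us →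
              (z ∈ x ∷ us → z ∈ x ∷ vs) → z ∈ us → z ∈ vs
    tails-∈ asym Rus sub z∈us with sub (there z∈us)
    ... | here refl  = ⊥-elim (asym (All.lookup Rus z∈us) (All.lookup Rus z∈us))
    ... | there z∈vs = z∈vs

  AllPairs-∈⇔⇒≡ : Asymmetric R → ∀ {xs ys} → AllPairs R xs → AllPairs R ys →
                  (∀ z → z ∈ xs ⇔ z ∈ ys) → xs ≡ ys
  AllPairs-∈⇔⇒≡ asym {[]}     {[]}     _ _ _ = refl
  AllPairs-∈⇔⇒≡ asym {[]}     {y ∷ _}  _ _ same with () ← from (same y) (here refl)
  AllPairs-∈⇔⇒≡ asym {x ∷ _}  {[]}     _ _ same with () ← to (same x) (here refl)
  AllPairs-∈⇔⇒≡ asym {x ∷ xs} {y ∷ ys} Rxxs@(Rx ∷ Rxs) Ryys@(Ry ∷ Rys) same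
    with refl ← heads-≡ asym Rxxs Ryys same =
    cong (x ∷_) (AllPairs-∈⇔⇒≡ asym Rxs Rys λ z →
      mk⇔ (tails-∈ asym Rx (to (same z))) (tails-∈ asym Ry (from (same z))))

increasing⇒avoids132 : ∀ {v} → AllPairs _<_ v → Avoids132 v
increasing⇒avoids132 inc (_ , _ , _ , _ , j<k , _ , vₖ<vⱼ) =
  <-asym vₖ<vⱼ (AllPairs-lookup inc j<k)

min∷avoids132⇒increasing : ∀ {m w} → All (m <_) w → Unique w → Avoids132 (m ∷ w) →
                           AllPairs _<_ w
min∷avoids132⇒increasing {m} {w} m<w distinct avoids = lookup⇒AllPairs increasing
  where
  increasing : ∀ {i j} → i <ᶠ j → lookup w i < lookup w j
  increasing {i} {j} i<j with <-cmp (lookup w i) (lookup w j)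
  ... | tri< wᵢ<wⱼ _ _ = wᵢ<wⱼ
  ... | tri≈ _ wᵢ≡wⱼ _ = contradiction wᵢ≡wⱼ (AllPairs-lookup distinct i<j)
  ... | tri> _ _ wⱼ<wᵢ =
    contradiction (fzero , fsuc i , fsuc j , s≤s z≤n , s≤s i<j , All.lookup m<w (∈-lookup j) , wⱼ<wᵢ)
                  avoids

CombGen⇒1≤ : ∀ {a b} → CombGen s t a b → 1 ≤ a
CombGen⇒1≤ (spine 1≤i _) = 1≤i
CombGen⇒1≤ (tooth 1≤x _) = 1≤x

CombGen⇒< : ∀ {a b} → CombGen s t a b → a < b
CombGen⇒< (spine _ _) = ≤-refl
CombGen⇒< {s = suc _}        (tooth {x} _ _)    = m<m+n x (s≤s z≤n)
CombGen⇒< {s = zero} {t = t} (tooth {x} 1≤x x≤) =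
  contradiction (≤-trans 1≤x (subst (x ≤_) (*-zeroʳ (t ∸ 1)) x≤)) λ ()

CombLe⇒≤ : ∀ {a b} → CombLe s t a b → a ≤ b
CombLe⇒≤ ε       = ≤-refl
CombLe⇒≤ (g ◅ r) = ≤-trans (<⇒≤ (CombGen⇒< g)) (CombLe⇒≤ r)

lowerCover : ∀ {x} → 2 ≤ x → x ≤ s * t → ∃[ z ] CombGen s t z x
lowerCover {x = 1} (s≤s ()) _
lowerCover {s} {t} {x@(suc (suc y))} _ x≤st with x ≤? s
... | yes x≤s = suc y , spine (s≤s z≤n) (∸-monoˡ-≤ 1 x≤s)
... | no x≰s  = x ∸ s , subst (CombGen s t (x ∸ s)) (m∸n+n≡m (<⇒≤ s<x)) (tooth 1≤x∸s x∸s≤)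
  where
  s<x : s < x
  s<x = ≰⇒> x≰s
  1≤x∸s : 1 ≤ x ∸ s
  1≤x∸s = subst (_≤ x ∸ s) (m+n∸n≡m 1 s) (∸-monoˡ-≤ s s<x)
  x∸s≤ : x ∸ s ≤ (t ∸ 1) * s
  x∸s≤ = begin
    x ∸ s          ≤⟨ ∸-monoˡ-≤ s x≤st ⟩
    s * t ∸ s      ≡⟨ cong₂ _∸_ (*-comm s t) (sym (*-identityˡ s)) ⟩
    t * s ∸ 1 * s  ≡⟨ sym (*-distribʳ-∸ s t 1) ⟩
    (t ∸ 1) * s    ∎
    where open ≤-Reasoning

listing-increasing⇒linExt : ∀ {v} → IsListingOf (s * t) v → AllPairs _<_ v → IsLinExt s t v
listing-increasing⇒linExt listing inc =
  listing , λ i j vᵢ≤vⱼ → ≮⇒≥ λ j<i → <⇒≱ (AllPairs-lookup inc j<i) (CombLe⇒≤ vᵢ≤vⱼ)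

linExt-head-minimal : ∀ {x w z} → IsLinExt s t (x ∷ w) → ¬ CombGen s t z x
linExt-head-minimal {s} {t} {x} {z = z} ((_ , members) , respects) z⋖x
  with _ , x≤st ← to (members x) (here refl)
  with from (members z) (CombGen⇒1≤ z⋖x , ≤-trans (<⇒≤ (CombGen⇒< z⋖x)) x≤st)
... | here refl  = <-irrefl refl (CombGen⇒< z⋖x)
... | there z∈w  with () ← respects (fsuc (Any.index z∈w)) fzero
                             (subst (λ y → CombLe s t y x) (lookup-index z∈w) (z⋖x ◅ ε))

linExt-head≡1 : ∀ {x w} → IsLinExt s t (x ∷ w) → x ≡ 1
linExt-head≡1 {x = 0}           ((_ , members) , _) with () ← to (members 0) (here refl)
linExt-head≡1 {x = 1}           _ = refl
linExt-head≡1 {x = suc (suc _)} lin@((_ , members) , _)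
  with _ , z⋖x ← lowerCover (s≤s (s≤s z≤n)) (proj₂ (to (members _) (here refl)))
  = contradiction z⋖x (linExt-head-minimal lin)

linExt-avoids132⇒increasing : ∀ {v} → IsLinExt s t v → Avoids132 v → AllPairs _<_ v
linExt-avoids132⇒increasing {v = []}    _ _ = []
linExt-avoids132⇒increasing {v = _ ∷ w} lin@(((head≢w ∷ distinct) , members) , _) avoids
  with refl ← linExt-head≡1 lin = 1<w ∷ min∷avoids132⇒increasing 1<w distinct avoids
  where
  1<w : All (1 <_) w
  1<w = All.tabulate λ y∈w → ≤∧≢⇒< (proj₁ (to (members _) (there y∈w))) (All.lookup head≢w y∈w)

oneTo : ℕ → List ℕ
oneTo = applyUpTo suc

oneTo-increasing : ∀ n → AllPairs _<_ (oneTo n)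
oneTo-increasing n = applyUpTo⁺₁ suc n λ i<j _ → s≤s i<j

oneTo-listing : ∀ n → IsListingOf n (oneTo n)
oneTo-listing n = AllPairs.map <⇒≢ (oneTo-increasing n) , λ x → mk⇔ (bounded x) (member x)
  where
  bounded : ∀ x → x ∈ oneTo n → 1 ≤ x × x ≤ n
  bounded x x∈ with _ , i<n , refl ← ∈-applyUpTo⁻ suc x∈ = s≤s z≤n , i<n
  member : ∀ x → 1 ≤ x × x ≤ n → x ∈ oneTo n
  member (suc i) (_ , i<n) = ∈-applyUpTo⁺ suc i<n

theorem4 : (s t : ℕ) → 1 ≤ s → 1 ≤ t →
    ∃[ v ] ((IsLinExt s t v × Avoids132 v) ×
      (∀ (w : List ℕ) → IsLinExt s t w → Avoids132 w → w ≡ v))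
theorem4 s t _ _ =
  oneTo (s * t) ,
  (listing-increasing⇒linExt listing increasing , increasing⇒avoids132 increasing) ,
  λ w lin avoids → AllPairs-∈⇔⇒≡ <-asym (linExt-avoids132⇒increasing lin avoids) increasing
                     λ z → ⇔.trans (proj₂ (proj₁ lin) z) (⇔.sym (proj₂ listing z))
  where
  listing : IsListingOf (s * t) (oneTo (s * t))
  listing = oneTo-listing (s * t)
  increasing : AllPairs _<_ (oneTo (s * t))
  increasing = oneTo-increasing (s * t)
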